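{- For all integers $n>0$ and $m\in\mathbb Z$, \[ \langle\mathrm{vac}|\,e^{ -\theta^*}\,\phi^{[\beta]*}_m\,\Phi^{(\beta)}_n\,e^{\theta^*}\,|\mathrm{vac}\rangle=\delta_{n,m}. \]
   Context: $\mathcal C$ is the associative $\mathbb Q(\beta)$-algebra generated by $\phi_n$ ($n\in\mathbb Z$) with $\phi_m\phi_n+\phi_n\phi_m=2(-1)^m\delta_{m+n,0}$; $|\mathrm{vac}\rangle$ satisfies $\phi_n|\mathrm{vac}\rangle=0$ for $n<0$ and $\langle\mathrm{vac}|$ satisfies $\langle\mathrm{vac}|\phi_n=0$ for $n>0$, with $\langle\mathrm{vac}|\mathrm{vac}\rangle=1$ and $\langle ua|v\rangle=\langle u|av\rangle$. $a\mapsto a^*$ is the anti-automorphism with $\phi_n^*=(-1)^n\phi_{ -n}$. Deformed fermions: $\sum_{n\ge0}\phi^{(\beta)}_nz^n=\sum_{n\ge0}\phi_n(z+\beta/2)^n$, $\sum_{n\ge1}\phi^{(\beta)}_{ -n}z^{ -n}=\sum_{n\ge1}\phi_{ -n}\big(\frac{z^{ -1}}{1+\frac\beta2z^{ -1}}\big)^n$, $\sum_{n\ge1}\phi^{[\beta]}_nz^n=\sum_{n\ge1}\phi_n\big(\frac{z}{1+\frac\beta2z}\big)^n$, $\sum_{n\ge0}\phi^{[\beta]}_{ -n}z^{ -n}=\sum_{n\ge0}\phi_{ -n}(z^{ -1}+\beta/2)^n$; $\phi^{[\beta]*}_m:=(\phi^{[\beta]}_m)^*$; $\Phi^{(\beta)}_n=\frac12\sum_{k\ge0}(-\beta/2)^k\phi^{(\beta)}_{n+k}$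 (coefficients of $(2+\beta z^{ -1})^{ -1}\sum_n\phi^{(\beta)}_nz^n$). For odd $n$, $b_n=\frac14\sum_i(-1)^i\phi_{ -i-n}\phi_i$, and $\theta^*=2\sum_{n>0\text{ odd}}(\beta/2)^nb_{ -n}/n$. -}

module Defs where

open import Data.Nat as ℕ using (ℕ; zero; suc)
open import Data.Nat.Combinatorics using (_C_)
open import Data.Nat.Base using (_!)
open import Data.Nat.ListAction using () renaming (sum to sumℕ)
open import Data.Integer as ℤ using (ℤ; +_; -[1+_])
open import Data.Rational as ℚ using (ℚ; 0ℚ; 1ℚ; ½)
open import Data.List as L using (List; []; _∷_; _++_; concatMap; map; foldr)
open import Data.Product using (_×_; _,_)
open import Relation.Nullary.Decidable.Core using (does)
open import Data.Bool using (Bool; true; false; if_then_else_)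

qpow : ℚ → ℕ → ℚ
qpow q zero    = 1ℚ
qpow q (suc k) = q ℚ.* qpow q k

-- the rational number 1/k  (only used for k ≠ 0)
inv : ℕ → ℚ
inv zero    = 0ℚ
inv (suc k) = + 1 ℚ./ suc k

fromℕ : ℕ → ℚ
fromℕ k = + k ℚ./ 1

sgnℕ : ℕ → ℚ
sgnℕ k = qpow (ℚ.- 1ℚ) k

sgnℤ : ℤ → ℚ
sgnℤ i = sgnℕ ℤ.∣ i ∣

sumTo : ℕ → (ℕ → ℚ) → ℚ
sumTo zero    f = f 0
sumTo (suc d) f = sumTo d f ℚ.+ f (suc d)

-- A basis state is a strictly decreasing list a₁ > a₂ > … > a_k ≥ 0 of
-- naturals, standing for  φ_{a₁} φ_{a₂} ⋯ φ_{a_k} |vac⟩ .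
-- A vector is a finite formal ℚ-linear combination of basis states
-- (not necessarily collected).

State : Set
State = List ℕ

FVec : Set
FVec = List (ℚ × State)

scaleV : ℚ → FVec → FVec
scaleV c = map (λ { (a , s) → (c ℚ.* a , s) })

prependV : ℕ → FVec → FVec
prependV x = map (λ { (a , s) → (a , x ∷ s) })

linV : (State → FVec) → FVec → FVec
linV f = concatMap (λ { (a , s) → scaleV a (f s) })

-- ⟨vac| v⟩ : coefficient of |vac⟩  (⟨vac|φ_{a₁}⋯φ_{a_k}|vac⟩ = 0 for k>0)
vev : FVec → ℚ
vev = foldr (λ { (a , []) r → a ℚ.+ r ; (a , (_ ∷ _)) r → r }) 0ℚ

-- φ_p with p ≥ 0 acting on a basis state, using
-- φ_p φ_a = - φ_a φ_p  (p ≠ a, p,a ≥ 0),  φ_p φ_p = δ_{p,0}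
φ⁺ : ℕ → State → FVec
φ⁺ p []      = (1ℚ , p ∷ []) ∷ []
φ⁺ p (a ∷ s) with ℕ.compare p a
... | ℕ.greater _ _ = (1ℚ , p ∷ a ∷ s) ∷ []
... | ℕ.equal _     = (if p ℕ.≡ᵇ 0 then (1ℚ , s) ∷ [] else [])
... | ℕ.less _ _    = scaleV (ℚ.- 1ℚ) (prependV a (φ⁺ p s))

-- φ_{-q} with q > 0 acting on a basis state, using φ_{-q}|vac⟩ = 0 and
-- φ_{-q} φ_a = - φ_a φ_{-q} + 2 (-1)^a δ_{a,q}
φ⁻ : ℕ → State → FVec
φ⁻ q []      = []
φ⁻ q (a ∷ s) =
  (if q ℕ.≡ᵇ a then (fromℕ 2 ℚ.* sgnℕ a , s) ∷ [] else [])
  ++ scaleV (ℚ.- 1ℚ) (prependV a (φ⁻ q s))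

φ : ℤ → FVec → FVec
φ (+ p)      = linV (φ⁺ p)
φ -[1+ q ]   = linV (φ⁻ (suc q))

-- finite ℚ-linear combinations of fermions  Σ c φ_i
Ferm : Set
Ferm = List (ℚ × ℤ)

actF : Ferm → FVec → FVec
actF f v = concatMap (λ { (c , i) → scaleV c (φ i v) }) f

starF : Ferm → Ferm
starF = map (λ { (c , i) → (sgnℤ i ℚ.* c , ℤ.- i) })

-- Every object below is a formal power series in β;
-- an operator series is given by its coefficients  ℕ → (FVec → FVec),
-- a vector series by  ℕ → FVec, a fermion series by  ℕ → Ferm.

OpS : Set
OpS = ℕ → FVec → FVec

VecS : Set
VecS = ℕ → FVec

sumToV : ℕ → (ℕ → FVec) → FVec
sumToV zero    f = f 0
sumToV (suc d) f = sumToV d f ++ f (suc d)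

applyS : OpS → VecS → VecS
applyS A v d = sumToV d (λ i → A i (v (d ℕ.∸ i)))

fermOp : (ℕ → Ferm) → OpS
fermOp f d = actF (f d)

-- coefficient of β^d in φ^{(β)}_p :
--   Σ_{n≥0} φ^{(β)}_n z^n = Σ_{n≥0} φ_n (z+β/2)^n   and
--   Σ_{n≥1} φ^{(β)}_{-n} z^{-n} = Σ_{n≥1} φ_{-n} (z^{-1}/(1+β z^{-1}/2))^n
-- (binomial expansion; for the second, (1+x)^{-k} = Σ_j (-1)^j C(k+j-1,j) x^j)
φβ : ℤ → ℕ → Ferm
φβ (+ q)    d = (fromℕ ((q ℕ.+ d) C q) ℚ.* qpow ½ d , + (q ℕ.+ d)) ∷ []
φβ -[1+ r ] d =
  if d ℕ.≤ᵇ r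
  then (sgnℕ d ℚ.* fromℕ (r C d) ℚ.* qpow ½ d , ℤ.- (+ (suc r ℕ.∸ d))) ∷ []
  else []

-- coefficient of β^d in φ^{[β]}_p :
--   Σ_{n≥1} φ^{[β]}_n z^n = Σ_{n≥1} φ_n (z/(1+βz/2))^n   and
--   Σ_{n≥0} φ^{[β]}_{-n} z^{-n} = Σ_{n≥0} φ_{-n} (z^{-1}+β/2)^n
φ[β] : ℤ → ℕ → Ferm
φ[β] (+ zero)  d = (qpow ½ d , ℤ.- (+ d)) ∷ []
φ[β] (+ suc r) d =
  if d ℕ.≤ᵇ r
  then (sgnℕ d ℚ.* fromℕ (r C d) ℚ.* qpow ½ d , + (suc r ℕ.∸ d)) ∷ []
  else []
φ[β] -[1+ q' ] d =
  let q = suc q' in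
  (fromℕ ((q ℕ.+ d) C q) ℚ.* qpow ½ d , ℤ.- (+ (q ℕ.+ d))) ∷ []

-- φ^{[β]*}_m = (φ^{[β]}_m)^*   (β is fixed by *)
φ[β]* : ℤ → ℕ → Ferm
φ[β]* m d = starF (φ[β] m d)

-- Φ^{(β)}_n = ½ Σ_{k≥0} (-β/2)^k φ^{(β)}_{n+k}
Φβ : ℤ → ℕ → Ferm
Φβ n d = concatMap (λ k → map (λ { (c , i) → (½ ℚ.* qpow (ℚ.- ½) k ℚ.* c , i) })
                              (φβ (n ℤ.+ + k) (d ℕ.∸ k)))
                   (L.upTo (suc d))

-- b_{-j} = ¼ Σ_{i∈ℤ} (-1)^i φ_{j-i} φ_i  (j odd) on a basis state s.
-- Only finitely many terms are nonzero on s: for i < -max s, φ_i s = 0,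
-- and for i > j + max s, φ_{j-i}φ_i s = -φ_iφ_{j-i} s = 0.  We sum over
-- i ∈ [-B, j+B] with B = 1 + Σ s ≥ 1 + max s, which drops only zero terms.
bneg : ℕ → State → FVec
bneg j s =
  let B = suc (sumℕ s)
      idx : ℕ → ℤ
      idx t = ℤ.- (+ B) ℤ.+ + t
  in concatMap (λ t → let i = idx t in
                 scaleV ((+ 1 ℚ./ 4) ℚ.* sgnℤ i)
                        (φ (+ j ℤ.- i) (φ i ((1ℚ , s) ∷ []))))
               (L.upTo (suc (j ℕ.+ 2 ℕ.* B)))

odd? : ℕ → Bool
odd? zero = false
odd? (suc zero) = true
odd? (suc (suc n)) = odd? n

-- θ* = 2 Σ_{n>0 odd} (β/2)^n b_{-n} / n : coefficient of β^j
θ* : OpS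
θ* j v = if odd? j then scaleV (fromℕ 2 ℚ.* qpow ½ j ℚ.* inv j) (linV (bneg j) v) else []

powApply : ℕ → OpS → VecS → VecS
powApply zero    A v = v
powApply (suc k) A v = applyS A (powApply k A v)

-- e^{c θ*} applied to a vector series.  Since θ* has no β^0 term,
-- (θ*^k v)_d = 0 for k > d, so the coefficient of β^d is a finite sum.
expθ* : ℚ → VecS → VecS
expθ* c v d = sumToV d (λ k → scaleV (qpow c k ℚ.* inv (k !)) (powApply k θ* v d))

vacS : VecS
vacS zero    = (1ℚ , []) ∷ []
vacS (suc _) = []

lhs : ℤ → ℤ → ℕ → ℚ
lhs n m d =
  vev (expθ* (ℚ.- 1ℚ)
        (applyS (fermOp (φ[β]* m))
          (applyS (fermOp (Φβ n))
            (expθ* 1ℚ vacS))) d)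

δS : ℤ → ℤ → ℕ → ℚ
δS n m zero    = if does (n ℤ.≟ m) then 1ℚ else 0ℚ
δS n m (suc _) = 0ℚ

{-# OPTIONS --safe #-}
-- Positive modes annihilate the bra: ⟨vac| φ_k = 0 for k > 0, and ⟨vac| φ_a φ_k is
-- ⟨vac|φ_a φ_k|vac⟩ ⟨vac|, which vanishes unless a + k = 0.  Every term φ_{j-i} φ_i of b_{-j}
-- (j > 0) is of one of these kinds with a + k = j ≠ 0, so ⟨vac| θ* = 0; hence both exponentials
-- drop out and the expectation is the single contraction ⟨vac| φ^{[β]*}_m Φ^{(β)}_n |vac⟩.
-- An alternating binomial sum telescopes to Φ^{(β)}_n = Σ_e ½ (β/2)^e C(n-1+e, n-1) φ_{n+e},
-- and φ^{[β]*}_m pairs with φ_{n+e} only when m = n + d at order β^d, leaving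
-- (β/2)^d Σ_i (-1)^i C(m-1, i) C(m-1-i, n-1): the coefficient of x^d in
-- (1-x)^{m-1} (1-x)^{-n} = (1-x)^{d-1}, that is δ_{d,0}.
module Submission where

open import Defs
open import Data.Bool using (true; false; if_then_else_)
open import Data.Empty using (⊥-elim)
open import Data.List as L using ([]; _∷_; _++_; concatMap)
import Data.List.Properties as LP
open import Data.Nat as ℕ using (ℕ; zero; suc; _∸_; _≤_; z≤n; s≤s)
open import Data.Nat.Base using (_!)
open import Data.Nat.Combinatorics using (_C_; nCk+nC[k+1]≡[n+1]C[k+1]; k>n⇒nCk≡0; nCn≡1)
import Data.Nat.Properties as ℕP
open import Data.Nat.ListAction using () renaming (sum to sumℕ)
open import Data.Integer as ℤ using (ℤ; +_; -[1+_]; _<_)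
import Data.Integer.Properties as ℤP
open import Data.Rational as ℚ using (ℚ; 0ℚ; 1ℚ; ½; _+_; _*_; _-_; -_)
import Data.Rational.Properties as ℚP
import Data.Rational.Unnormalised as ℚᵘ
import Data.Rational.Unnormalised.Properties as ℚᵘP
open import Data.Rational.Solver using (module +-*-Solver)
open import Data.Product using (_,_)
open import Relation.Binary.PropositionalEquality
open import Relation.Nullary using (¬_; yes; no)
open import Relation.Nullary.Decidable using (dec-true; dec-false)
open +-*-Solver using (solve; _:+_; _:*_; _:-_; :-_; con; _:=_)
open ≡-Reasoning

sumTo-cong : ∀ d {f g : ℕ → ℚ} → (∀ k → k ≤ d → f k ≡ g k) → sumTo d f ≡ sumTo d g
sumTo-cong zero f≗g = f≗g 0 z≤n
sumTo-cong (suc d) f≗g =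
  cong₂ _+_ (sumTo-cong d (λ k k≤d → f≗g k (ℕP.m≤n⇒m≤1+n k≤d))) (f≗g (suc d) ℕP.≤-refl)

sumTo-zero : ∀ d (f : ℕ → ℚ) → (∀ k → k ≤ d → f k ≡ 0ℚ) → sumTo d f ≡ 0ℚ
sumTo-zero zero f f≗0 = f≗0 0 z≤n
sumTo-zero (suc d) f f≗0 =
  cong₂ _+_ (sumTo-zero d f (λ k k≤d → f≗0 k (ℕP.m≤n⇒m≤1+n k≤d))) (f≗0 (suc d) ℕP.≤-refl)

sumTo-head : ∀ d (f : ℕ → ℚ) → (∀ k → f (suc k) ≡ 0ℚ) → sumTo d f ≡ f 0
sumTo-head zero f f≗0 = refl
sumTo-head (suc d) f f≗0 =
  trans (cong₂ _+_ (sumTo-head d f f≗0) (f≗0 d)) (ℚP.+-identityʳ (f 0))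

sumTo-last : ∀ d (f : ℕ → ℚ) → (∀ k → k ℕ.< d → f k ≡ 0ℚ) → sumTo d f ≡ f d
sumTo-last zero f f≗0 = refl
sumTo-last (suc d) f f≗0 =
  trans (cong (_+ f (suc d)) (sumTo-zero d f (λ k k≤d → f≗0 k (s≤s k≤d)))) (ℚP.+-identityˡ (f (suc d)))

sumTo-suc : ∀ d (f : ℕ → ℚ) → sumTo (suc d) f ≡ f 0 + sumTo d (λ i → f (suc i))
sumTo-suc zero f = refl
sumTo-suc (suc d) f =
  trans (cong (_+ f (suc (suc d))) (sumTo-suc d f)) (ℚP.+-assoc (f 0) _ (f (suc (suc d))))

sumTo-*ˡ : ∀ d (f : ℕ → ℚ) x → sumTo d (λ k → x * f k) ≡ x * sumTo d f
sumTo-*ˡ zero f x = refl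
sumTo-*ˡ (suc d) f x =
  trans (cong (_+ x * f (suc d)) (sumTo-*ˡ d f x)) (sym (ℚP.*-distribˡ-+ x (sumTo d f) (f (suc d))))

sumTo-*ʳ : ∀ d (f : ℕ → ℚ) x → sumTo d (λ k → f k * x) ≡ sumTo d f * x
sumTo-*ʳ zero f x = refl
sumTo-*ʳ (suc d) f x =
  trans (cong (_+ f (suc d) * x) (sumTo-*ʳ d f x)) (sym (ℚP.*-distribʳ-+ x (sumTo d f) (f (suc d))))

sumTo-- : ∀ d (f g : ℕ → ℚ) → sumTo d (λ i → f i - g i) ≡ sumTo d f - sumTo d g
sumTo-- zero f g = refl
sumTo-- (suc d) f g =
  trans (cong (_+ (f (suc d) - g (suc d))) (sumTo-- d f g))
        (interchange (sumTo d f) (sumTo d g) (f (suc d)) (g (suc d)))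
  where
  interchange : ∀ a b x y → (a - b) + (x - y) ≡ (a + x) - (b + y)
  interchange = solve 4 (λ a b x y → (a :- b) :+ (x :- y) := (a :+ x) :- (b :+ y)) refl

shift : (ℕ → ℚ) → ℕ → ℚ
shift f zero = 0ℚ
shift f (suc i) = f i

sumTo-shift : ∀ d f → sumTo (suc d) (shift f) ≡ sumTo d f
sumTo-shift d f = trans (sumTo-suc d (shift f)) (ℚP.+-identityˡ (sumTo d f))

Covec : Set
Covec = State → ℚ

⟨_∣_⟩ : Covec → FVec → ℚ
⟨ g ∣ [] ⟩ = 0ℚ
⟨ g ∣ (a , s) ∷ v ⟩ = a * g s + ⟨ g ∣ v ⟩

⟨∣⟩-++ : ∀ g v w → ⟨ g ∣ v ++ w ⟩ ≡ ⟨ g ∣ v ⟩ + ⟨ g ∣ w ⟩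
⟨∣⟩-++ g [] w = sym (ℚP.+-identityˡ _)
⟨∣⟩-++ g ((a , s) ∷ v) w =
  trans (cong (_+_ (a * g s)) (⟨∣⟩-++ g v w)) (sym (ℚP.+-assoc (a * g s) _ _))

⟨∣⟩-scaleV : ∀ g c v → ⟨ g ∣ scaleV c v ⟩ ≡ c * ⟨ g ∣ v ⟩
⟨∣⟩-scaleV g c [] = sym (ℚP.*-zeroʳ c)
⟨∣⟩-scaleV g c ((a , s) ∷ v) =
  trans (cong₂ _+_ (ℚP.*-assoc c a (g s)) (⟨∣⟩-scaleV g c v)) (sym (ℚP.*-distribˡ-+ c _ _))

⟨∣⟩-scaleV-zero : ∀ g c v → ⟨ g ∣ v ⟩ ≡ 0ℚ → ⟨ g ∣ scaleV c v ⟩ ≡ 0ℚ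
⟨∣⟩-scaleV-zero g c v gv≡0 =
  trans (⟨∣⟩-scaleV g c v) (trans (cong (c *_) gv≡0) (ℚP.*-zeroʳ c))

⟨∣⟩-prependV : ∀ g x v → ⟨ g ∣ prependV x v ⟩ ≡ ⟨ (λ t → g (x ∷ t)) ∣ v ⟩
⟨∣⟩-prependV g x [] = refl
⟨∣⟩-prependV g x ((a , s) ∷ v) = cong (_+_ (a * g (x ∷ s))) (⟨∣⟩-prependV g x v)

⟨∣⟩-linV : ∀ g f v → ⟨ g ∣ linV f v ⟩ ≡ ⟨ (λ s → ⟨ g ∣ f s ⟩) ∣ v ⟩
⟨∣⟩-linV g f [] = refl
⟨∣⟩-linV g f ((a , s) ∷ v) =
  trans (⟨∣⟩-++ g (scaleV a (f s)) (linV f v))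
        (cong₂ _+_ (⟨∣⟩-scaleV g a (f s)) (⟨∣⟩-linV g f v))

⟨∣⟩-cong : ∀ {g h} v → (∀ s → g s ≡ h s) → ⟨ g ∣ v ⟩ ≡ ⟨ h ∣ v ⟩
⟨∣⟩-cong [] g≗h = refl
⟨∣⟩-cong ((a , s) ∷ v) g≗h = cong₂ (λ x y → a * x + y) (g≗h s) (⟨∣⟩-cong v g≗h)

⟨*∣⟩ : ∀ g c v → ⟨ (λ s → c * g s) ∣ v ⟩ ≡ c * ⟨ g ∣ v ⟩
⟨*∣⟩ g c [] = sym (ℚP.*-zeroʳ c)
⟨*∣⟩ g c ((a , s) ∷ v) =
  trans (cong₂ _+_ (swap-factors a c (g s)) (⟨*∣⟩ g c v)) (sym (ℚP.*-distribˡ-+ c _ _))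
  where
  swap-factors : ∀ a c x → a * (c * x) ≡ c * (a * x)
  swap-factors = solve 3 (λ a c x → a :* (c :* x) := c :* (a :* x)) refl

⟨∣⟩-zero : ∀ {g} v → (∀ s → g s ≡ 0ℚ) → ⟨ g ∣ v ⟩ ≡ 0ℚ
⟨∣⟩-zero [] g≗0 = refl
⟨∣⟩-zero ((a , s) ∷ v) g≗0 =
  trans (cong₂ (λ x y → a * x + y) (g≗0 s) (⟨∣⟩-zero v g≗0))
        (trans (ℚP.+-identityʳ _) (ℚP.*-zeroʳ a))

⟨∣⟩-−prependV-zero : ∀ g x v → (∀ t → g (x ∷ t) ≡ 0ℚ) →
                     ⟨ g ∣ scaleV (- 1ℚ) (prependV x v) ⟩ ≡ 0ℚ
⟨∣⟩-−prependV-zero g x v g≗0 =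
  ⟨∣⟩-scaleV-zero g (- 1ℚ) (prependV x v) (trans (⟨∣⟩-prependV g x v) (⟨∣⟩-zero v g≗0))

⟨∣⟩-concatMap-zero : ∀ {A : Set} g (F : A → FVec) xs →
                     (∀ x → ⟨ g ∣ F x ⟩ ≡ 0ℚ) → ⟨ g ∣ concatMap F xs ⟩ ≡ 0ℚ
⟨∣⟩-concatMap-zero g F [] F≗0 = refl
⟨∣⟩-concatMap-zero g F (x ∷ xs) F≗0 =
  trans (⟨∣⟩-++ g (F x) (concatMap F xs))
        (cong₂ _+_ (F≗0 x) (⟨∣⟩-concatMap-zero g F xs F≗0))

⟨∣⟩-sumToV : ∀ g d (F : ℕ → FVec) → ⟨ g ∣ sumToV d F ⟩ ≡ sumTo d (λ k → ⟨ g ∣ F k ⟩)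
⟨∣⟩-sumToV g zero F = refl
⟨∣⟩-sumToV g (suc d) F =
  trans (⟨∣⟩-++ g (sumToV d F) (F (suc d))) (cong (_+ ⟨ g ∣ F (suc d) ⟩) (⟨∣⟩-sumToV g d F))

vac∣ : Covec
vac∣ [] = 1ℚ
vac∣ (_ ∷ _) = 0ℚ

vev≡⟨vac∣⟩ : ∀ v → vev v ≡ ⟨ vac∣ ∣ v ⟩
vev≡⟨vac∣⟩ [] = refl
vev≡⟨vac∣⟩ ((a , []) ∷ v) = cong₂ _+_ (sym (ℚP.*-identityʳ a)) (vev≡⟨vac∣⟩ v)
vev≡⟨vac∣⟩ ((a , _ ∷ _) ∷ v) =
  trans (vev≡⟨vac∣⟩ v) (sym (trans (cong (_+ ⟨ vac∣ ∣ v ⟩) (ℚP.*-zeroʳ a)) (ℚP.+-identityˡ _)))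

φ-basis : ℤ → State → FVec
φ-basis (+ p) = φ⁺ p
φ-basis -[1+ q ] = φ⁻ (suc q)

infixl 5 _·φ_
_·φ_ : Covec → ℤ → Covec
(g ·φ a) s = ⟨ g ∣ φ-basis a s ⟩

⟨∣⟩-φ : ∀ g a v → ⟨ g ∣ φ a v ⟩ ≡ ⟨ g ·φ a ∣ v ⟩
⟨∣⟩-φ g (+ p) v = ⟨∣⟩-linV g (φ⁺ p) v
⟨∣⟩-φ g -[1+ q ] v = ⟨∣⟩-linV g (φ⁻ (suc q)) v

⟪_∣_⟫ : Ferm → (ℤ → ℚ) → ℚ
⟪ [] ∣ X ⟫ = 0ℚ
⟪ (c , a) ∷ f ∣ X ⟫ = c * X a + ⟪ f ∣ X ⟫

⟪⟫-++ : ∀ f g X → ⟪ f ++ g ∣ X ⟫ ≡ ⟪ f ∣ X ⟫ + ⟪ g ∣ X ⟫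
⟪⟫-++ [] g X = sym (ℚP.+-identityˡ _)
⟪⟫-++ ((c , a) ∷ f) g X =
  trans (cong (_+_ (c * X a)) (⟪⟫-++ f g X)) (sym (ℚP.+-assoc (c * X a) _ _))

⟪⟫-cong : ∀ f {X Y} → (∀ a → X a ≡ Y a) → ⟪ f ∣ X ⟫ ≡ ⟪ f ∣ Y ⟫
⟪⟫-cong [] X≗Y = refl
⟪⟫-cong ((c , a) ∷ f) X≗Y = cong₂ (λ x y → c * x + y) (X≗Y a) (⟪⟫-cong f X≗Y)

⟪⟫-concatMap-upTo : ∀ (G : ℕ → Ferm) e X →
                    ⟪ concatMap G (L.upTo (suc e)) ∣ X ⟫ ≡ sumTo e (λ k → ⟪ G k ∣ X ⟫)
⟪⟫-concatMap-upTo G zero X = trans (⟪⟫-++ (G 0) [] X) (ℚP.+-identityʳ _)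
⟪⟫-concatMap-upTo G (suc e) X = begin
  ⟪ concatMap G (L.upTo (suc (suc e))) ∣ X ⟫
    ≡⟨ cong (λ ks → ⟪ concatMap G ks ∣ X ⟫) (sym (LP.upTo-∷ʳ (suc e))) ⟩
  ⟪ concatMap G (L.upTo (suc e) ++ suc e ∷ []) ∣ X ⟫
    ≡⟨ cong ⟪_∣ X ⟫ (LP.concatMap-++ G (L.upTo (suc e)) (suc e ∷ [])) ⟩
  ⟪ concatMap G (L.upTo (suc e)) ++ (G (suc e) ++ []) ∣ X ⟫
    ≡⟨ ⟪⟫-++ (concatMap G (L.upTo (suc e))) (G (suc e) ++ []) X ⟩
  ⟪ concatMap G (L.upTo (suc e)) ∣ X ⟫ + ⟪ G (suc e) ++ [] ∣ X ⟫
    ≡⟨ cong₂ _+_ (⟪⟫-concatMap-upTo G e X) (⟪⟫-concatMap-upTo (λ _ → G (suc e)) zero X) ⟩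
  sumTo (suc e) (λ k → ⟪ G k ∣ X ⟫) ∎

⟨∣⟩-actF : ∀ g f v → ⟨ g ∣ actF f v ⟩ ≡ ⟪ f ∣ (λ a → ⟨ g ·φ a ∣ v ⟩) ⟫
⟨∣⟩-actF g [] v = refl
⟨∣⟩-actF g ((c , a) ∷ f) v =
  trans (⟨∣⟩-++ g (scaleV c (φ a v)) (actF f v))
        (cong₂ _+_ (trans (⟨∣⟩-scaleV g c (φ a v)) (cong (c *_) (⟨∣⟩-φ g a v))) (⟨∣⟩-actF g f v))

⟨∣⟩-applyS-fermOp : ∀ g f V d →
  ⟨ g ∣ applyS (fermOp f) V d ⟩ ≡ sumTo d (λ i → ⟪ f i ∣ (λ a → ⟨ g ·φ a ∣ V (d ∸ i) ⟩) ⟫)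
⟨∣⟩-applyS-fermOp g f V d =
  trans (⟨∣⟩-sumToV g d (λ i → actF (f i) (V (d ∸ i))))
        (sumTo-cong d (λ i _ → ⟨∣⟩-actF g (f i) (V (d ∸ i))))

-- ⟨vac| φ_a φ_k |vac⟩ for k > 0
vacPair : ℤ → ℕ → ℚ
vacPair (+ _) k = 0ℚ
vacPair -[1+ p ] k = if suc p ℕ.≡ᵇ k then fromℕ 2 * sgnℕ k else 0ℚ

vacPair-diag : ∀ p → vacPair -[1+ p ] (suc p) ≡ fromℕ 2 * sgnℕ (suc p)
vacPair-diag p with p ℕ.≡ᵇ p | ℕP.≡⇒≡ᵇ p p refl
... | true | _ = refl

vacPair-offdiag : ∀ p q → p ≢ q → vacPair -[1+ p ] (suc q) ≡ 0ℚ
vacPair-offdiag p q p≢q with p ℕ.≡ᵇ q | ℕP.≡ᵇ⇒≡ p q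
... | true | p≡q = ⊥-elim (p≢q (p≡q _))
... | false | _ = refl

vacPair-charge : ∀ a k → a ℤ.+ + k ≢ + 0 → vacPair a k ≡ 0ℚ
vacPair-charge (+ _) k _ = refl
vacPair-charge -[1+ p ] zero _ = refl
vacPair-charge -[1+ p ] (suc q) a+k≢0 =
  vacPair-offdiag p q λ { refl → a+k≢0 (ℤP.+-inverseˡ (+ suc p)) }

⟨∣⟩-φ⁺-positive : ∀ h q s → (∀ x t → h (suc x ∷ t) ≡ 0ℚ) → ⟨ h ∣ φ⁺ (suc q) s ⟩ ≡ 0ℚ
⟨∣⟩-φ⁺-positive h q [] h≗0 = cong (λ y → 1ℚ * y + 0ℚ) (h≗0 q [])
⟨∣⟩-φ⁺-positive h q (x ∷ r) h≗0 with ℕ.compare (suc q) x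
... | ℕ.greater _ k = cong (λ y → 1ℚ * y + 0ℚ) (h≗0 _ _)
... | ℕ.equal _ = refl
... | ℕ.less _ k =
  ⟨∣⟩-−prependV-zero h _ (φ⁺ (suc q) r) (h≗0 _)

vac·φ⁺ : ∀ p s → (vac∣ ·φ (+ suc p)) s ≡ 0ℚ
vac·φ⁺ p s = ⟨∣⟩-φ⁺-positive vac∣ p s (λ _ _ → refl)

vev-φ⁺ : ∀ p v → ⟨ vac∣ ∣ φ (+ suc p) v ⟩ ≡ 0ℚ
vev-φ⁺ p v = trans (⟨∣⟩-φ vac∣ (+ suc p) v) (⟨∣⟩-zero v (vac·φ⁺ p))

vac·φ⁻-∷ : ∀ p y t → (vac∣ ·φ -[1+ p ]) (y ∷ t) ≡ vacPair -[1+ p ] y * vac∣ t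
vac·φ⁻-∷ p y t with suc p ℕ.≡ᵇ y
... | true = trans (⟨∣⟩-++ vac∣ ((c , t) ∷ []) rest)
                   (trans (cong₂ _+_ (ℚP.+-identityʳ (c * vac∣ t)) rest≡0) (ℚP.+-identityʳ _))
  where
  c = fromℕ 2 * sgnℕ y
  rest = scaleV (- 1ℚ) (prependV y (φ⁻ (suc p) t))
  rest≡0 : ⟨ vac∣ ∣ rest ⟩ ≡ 0ℚ
  rest≡0 = ⟨∣⟩-−prependV-zero vac∣ y (φ⁻ (suc p) t) (λ _ → refl)
... | false = trans (⟨∣⟩-−prependV-zero vac∣ y (φ⁻ (suc p) t) (λ _ → refl))
                    (sym (ℚP.*-zeroˡ (vac∣ t)))

⟨vac·φ⁻∣prependV⟩ : ∀ p y w →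
  ⟨ vac∣ ·φ -[1+ p ] ∣ prependV y w ⟩ ≡ vacPair -[1+ p ] y * ⟨ vac∣ ∣ w ⟩
⟨vac·φ⁻∣prependV⟩ p y w = begin
  ⟨ vac∣ ·φ -[1+ p ] ∣ prependV y w ⟩                ≡⟨ ⟨∣⟩-prependV (vac∣ ·φ -[1+ p ]) y w ⟩
  ⟨ (λ t → (vac∣ ·φ -[1+ p ]) (y ∷ t)) ∣ w ⟩         ≡⟨ ⟨∣⟩-cong w (vac·φ⁻-∷ p y) ⟩
  ⟨ (λ t → vacPair -[1+ p ] y * vac∣ t) ∣ w ⟩        ≡⟨ ⟨*∣⟩ vac∣ (vacPair -[1+ p ] y) w ⟩
  vacPair -[1+ p ] y * ⟨ vac∣ ∣ w ⟩                  ∎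

vac·φ⁻·φ⁺-∷ : ∀ p q x r → ⟨ vac∣ ·φ -[1+ p ] ∣ φ⁺ (suc q) (x ∷ r) ⟩ ≡ 0ℚ
vac·φ⁻·φ⁺-∷ p q x r with ℕ.compare (suc q) x
... | ℕ.greater _ k =
  cong (λ y → 1ℚ * y + 0ℚ) (trans (vac·φ⁻-∷ p (suc (x ℕ.+ k)) (x ∷ r))
                                   (ℚP.*-zeroʳ (vacPair -[1+ p ] (suc (x ℕ.+ k)))))
... | ℕ.equal _ = refl
... | ℕ.less _ k =
  ⟨∣⟩-scaleV-zero (vac∣ ·φ -[1+ p ]) (- 1ℚ) (prependV y (φ⁺ (suc q) r))
    (trans (⟨vac·φ⁻∣prependV⟩ p y (φ⁺ (suc q) r))
           (trans (cong (vacPair -[1+ p ] y *_) (vac·φ⁺ q r)) (ℚP.*-zeroʳ (vacPair -[1+ p ] y))))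
  where y = suc (suc q ℕ.+ k)

vac·φ·φ⁺ : ∀ a q s → ((vac∣ ·φ a) ·φ (+ suc q)) s ≡ vacPair a (suc q) * vac∣ s
vac·φ·φ⁺ (+ suc p) q s =
  trans (⟨∣⟩-zero (φ⁺ (suc q) s) (vac·φ⁺ p)) (sym (ℚP.*-zeroˡ (vac∣ s)))
vac·φ·φ⁺ (+ zero) q s =
  trans (⟨∣⟩-φ⁺-positive (vac∣ ·φ + 0) q s vac·φ₀-∷)
        (sym (ℚP.*-zeroˡ (vac∣ s)))
  where
  vac·φ₀-∷ : ∀ x t → (vac∣ ·φ + 0) (suc x ∷ t) ≡ 0ℚ
  vac·φ₀-∷ x t = ⟨∣⟩-−prependV-zero vac∣ (suc x) (φ⁺ 0 t) (λ _ → refl)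
vac·φ·φ⁺ -[1+ p ] q [] =
  trans (ℚP.+-identityʳ _) (trans (ℚP.*-identityˡ _) (vac·φ⁻-∷ p (suc q) []))
vac·φ·φ⁺ -[1+ p ] q (x ∷ r) =
  trans (vac·φ⁻·φ⁺-∷ p q x r) (sym (ℚP.*-zeroʳ (vacPair -[1+ p ] (suc q))))

⟨vac·φ·φ⁺∣⟩ : ∀ a q w →
  ⟨ (vac∣ ·φ a) ·φ (+ suc q) ∣ w ⟩ ≡ vacPair a (suc q) * ⟨ vac∣ ∣ w ⟩
⟨vac·φ·φ⁺∣⟩ a q w = trans (⟨∣⟩-cong w (vac·φ·φ⁺ a q)) (⟨*∣⟩ vac∣ (vacPair a (suc q)) w)

vev-φφ-charged : ∀ j i w → ⟨ vac∣ ∣ φ (+ suc j ℤ.- i) (φ i w) ⟩ ≡ 0ℚ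
vev-φφ-charged j (+ suc q) w = begin
  ⟨ vac∣ ∣ φ a (φ (+ suc q) w) ⟩        ≡⟨ ⟨∣⟩-φ vac∣ a _ ⟩
  ⟨ vac∣ ·φ a ∣ φ (+ suc q) w ⟩          ≡⟨ ⟨∣⟩-φ (vac∣ ·φ a) (+ suc q) w ⟩
  ⟨ (vac∣ ·φ a) ·φ (+ suc q) ∣ w ⟩       ≡⟨ ⟨vac·φ·φ⁺∣⟩ a q w ⟩
  vacPair a (suc q) * ⟨ vac∣ ∣ w ⟩
    ≡⟨ cong (_* ⟨ vac∣ ∣ w ⟩) (vacPair-charge a (suc q) charge≢0) ⟩
  0ℚ * ⟨ vac∣ ∣ w ⟩                      ≡⟨ ℚP.*-zeroˡ ⟨ vac∣ ∣ w ⟩ ⟩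
  0ℚ ∎
  where
  a = + suc j ℤ.- + suc q
  a+q≡j : a ℤ.+ + suc q ≡ + suc j
  a+q≡j = begin
    + suc j ℤ.+ ℤ.- (+ suc q) ℤ.+ + suc q     ≡⟨ ℤP.+-assoc (+ suc j) (ℤ.- (+ suc q)) (+ suc q) ⟩
    + suc j ℤ.+ (ℤ.- (+ suc q) ℤ.+ + suc q)   ≡⟨ cong (ℤ._+_ (+ suc j)) (ℤP.+-inverseˡ (+ suc q)) ⟩
    + suc j ℤ.+ + 0                           ≡⟨ ℤP.+-identityʳ (+ suc j) ⟩
    + suc j                                   ∎
  charge≢0 : a ℤ.+ + suc q ≢ + 0
  charge≢0 eq = ℕP.1+n≢0 (ℤP.+-injective (trans (sym a+q≡j) eq))
vev-φφ-charged j (+ zero) w = vev-φ⁺ (j ℕ.+ 0) (φ (+ 0) w)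
vev-φφ-charged j -[1+ q ] w = vev-φ⁺ (j ℕ.+ suc q) (φ -[1+ q ] w)

vev-bneg : ∀ j s → ⟨ vac∣ ∣ bneg (suc j) s ⟩ ≡ 0ℚ
vev-bneg j s = ⟨∣⟩-concatMap-zero vac∣ term (L.upTo (suc (suc j ℕ.+ 2 ℕ.* B)))
  (λ t → ⟨∣⟩-scaleV-zero vac∣ (c t) (φφ t) (vev-φφ-charged j (i t) _))
  where
  B = suc (sumℕ s)
  i : ℕ → ℤ
  i t = ℤ.- (+ B) ℤ.+ + t
  c : ℕ → ℚ
  c t = + 1 ℚ./ 4 * sgnℤ (i t)
  φφ : ℕ → FVec
  φφ t = φ (+ suc j ℤ.- i t) (φ (i t) ((1ℚ , s) ∷ []))
  term : ℕ → FVec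
  term t = scaleV (c t) (φφ t)

vev-θ* : ∀ j w → ⟨ vac∣ ∣ θ* j w ⟩ ≡ 0ℚ
vev-θ* zero w = refl
vev-θ* (suc j) w with odd? (suc j)
... | false = refl
... | true = ⟨∣⟩-scaleV-zero vac∣ (fromℕ 2 * qpow ½ (suc j) * inv (suc j)) (linV (bneg (suc j)) w)
               (trans (⟨∣⟩-linV vac∣ (bneg (suc j)) w) (⟨∣⟩-zero w (vev-bneg j)))

vev-θ*-power : ∀ k V d → ⟨ vac∣ ∣ powApply (suc k) θ* V d ⟩ ≡ 0ℚ
vev-θ*-power k V d =
  trans (⟨∣⟩-sumToV vac∣ d (λ i → θ* i (powApply k θ* V (d ∸ i))))
        (sumTo-zero d _ (λ i _ → vev-θ* i (powApply k θ* V (d ∸ i))))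

vev-expθ* : ∀ c V d → ⟨ vac∣ ∣ expθ* c V d ⟩ ≡ ⟨ vac∣ ∣ V d ⟩
vev-expθ* c V d = begin
  ⟨ vac∣ ∣ expθ* c V d ⟩                ≡⟨ ⟨∣⟩-sumToV vac∣ d term ⟩
  sumTo d (λ k → ⟨ vac∣ ∣ term k ⟩)      ≡⟨ sumTo-head d _ higher-terms-vanish ⟩
  ⟨ vac∣ ∣ scaleV (coeff 0) (V d) ⟩      ≡⟨ ⟨∣⟩-scaleV vac∣ (coeff 0) (V d) ⟩
  1ℚ * ⟨ vac∣ ∣ V d ⟩                    ≡⟨ ℚP.*-identityˡ _ ⟩
  ⟨ vac∣ ∣ V d ⟩                         ∎
  where
  coeff : ℕ → ℚ
  coeff k = qpow c k * inv (k !)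
  term : ℕ → FVec
  term k = scaleV (coeff k) (powApply k θ* V d)
  higher-terms-vanish : ∀ k → ⟨ vac∣ ∣ term (suc k) ⟩ ≡ 0ℚ
  higher-terms-vanish k =
    ⟨∣⟩-scaleV-zero vac∣ (coeff (suc k)) (powApply (suc k) θ* V d) (vev-θ*-power k V d)

vev-vacS : ∀ e i → i ℕ.< e → ⟨ vac∣ ∣ vacS (e ∸ i) ⟩ ≡ 0ℚ
vev-vacS (suc e) zero _ = refl
vev-vacS (suc e) (suc i) (s≤s i<e) = vev-vacS e i i<e

fromℕ-+ : ∀ a b → fromℕ (a ℕ.+ b) ≡ fromℕ a + fromℕ b
fromℕ-+ a b = ℚP.toℚᵘ-injective
  (ℚᵘP.≃-trans (ℚP.toℚᵘ-fromℚᵘ (ℚᵘ.mkℚᵘ (+ (a ℕ.+ b)) 0))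
  (ℚᵘP.≃-trans (ℚᵘP.≃-reflexive numerators)
  (ℚᵘP.≃-trans (ℚᵘP.+-cong (ℚᵘP.≃-sym (ℚP.toℚᵘ-fromℚᵘ (ℚᵘ.mkℚᵘ (+ a) 0)))
                           (ℚᵘP.≃-sym (ℚP.toℚᵘ-fromℚᵘ (ℚᵘ.mkℚᵘ (+ b) 0))))
               (ℚᵘP.≃-sym (ℚP.toℚᵘ-homo-+ (fromℕ a) (fromℕ b))))))
  where
  numerators : ℚᵘ.mkℚᵘ (+ (a ℕ.+ b)) 0 ≡ ℚᵘ.mkℚᵘ (+ a) 0 ℚᵘ.+ ℚᵘ.mkℚᵘ (+ b) 0
  numerators = cong (λ z → ℚᵘ.mkℚᵘ z 0)
                    (sym (cong₂ ℤ._+_ (ℤP.*-identityʳ (+ a)) (ℤP.*-identityʳ (+ b))))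

qpow-+ : ∀ x i j → qpow x (i ℕ.+ j) ≡ qpow x i * qpow x j
qpow-+ x zero j = sym (ℚP.*-identityˡ (qpow x j))
qpow-+ x (suc i) j = trans (cong (x *_) (qpow-+ x i j)) (sym (ℚP.*-assoc x (qpow x i) (qpow x j)))

qpow-split : ∀ x {i e} → i ≤ e → qpow x i * qpow x (e ∸ i) ≡ qpow x e
qpow-split x {i} {e} i≤e = trans (sym (qpow-+ x i (e ∸ i))) (cong (qpow x) (ℕP.m+[n∸m]≡n i≤e))

qpow-neg : ∀ x k → qpow (- x) k ≡ sgnℕ k * qpow x k
qpow-neg x zero = refl
qpow-neg x (suc k) = trans (cong (- x *_) (qpow-neg x k)) (pull-sign x (sgnℕ k) (qpow x k))
  where
  pull-sign : ∀ x s q → - x * (s * q) ≡ (- 1ℚ * s) * (x * q)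
  pull-sign = solve 3 (λ x s q → (:- x) :* (s :* q) := ((:- con 1ℚ) :* s) :* (x :* q)) refl

sgnℕ-square : ∀ k → sgnℕ k * sgnℕ k ≡ 1ℚ
sgnℕ-square zero = refl
sgnℕ-square (suc k) = trans (square-neg (sgnℕ k)) (sgnℕ-square k)
  where
  square-neg : ∀ s → (- 1ℚ * s) * (- 1ℚ * s) ≡ s * s
  square-neg = solve 1 (λ s → ((:- con 1ℚ) :* s) :* ((:- con 1ℚ) :* s) := s :* s) refl

alternating-telescope : ∀ e (u : ℕ → ℚ) →
  sumTo e (λ k → sgnℕ k * (u k + u (suc k))) ≡ u 0 + sgnℕ e * u (suc e)
alternating-telescope zero u = base (u 0) (u 1)
  where
  base : ∀ x y → 1ℚ * (x + y) ≡ x + 1ℚ * y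
  base = solve 2 (λ x y → con 1ℚ :* (x :+ y) := x :+ con 1ℚ :* y) refl
alternating-telescope (suc e) u =
  trans (cong (_+ sgnℕ (suc e) * (u (suc e) + u (suc (suc e)))) (alternating-telescope e u))
        (step (u 0) (sgnℕ e) (u (suc e)) (u (suc (suc e))))
  where
  step : ∀ c s x y → (c + s * x) + (- 1ℚ * s) * (x + y) ≡ c + (- 1ℚ * s) * y
  step = solve 4 (λ c s x y → (c :+ s :* x) :+ ((:- con 1ℚ) :* s) :* (x :+ y)
                              := c :+ ((:- con 1ℚ) :* s) :* y) refl

alternating-binomial-tail : ∀ A B e →
  sumTo e (λ k → sgnℕ k * fromℕ (suc A C suc (k ℕ.+ B)))
    ≡ fromℕ (A C B) + sgnℕ e * fromℕ (A C suc (e ℕ.+ B))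
alternating-binomial-tail A B e =
  trans (sumTo-cong e (λ k _ → cong (sgnℕ k *_) (pascal k)))
        (alternating-telescope e (λ k → fromℕ (A C (k ℕ.+ B))))
  where
  pascal : ∀ k → fromℕ (suc A C suc (k ℕ.+ B)) ≡ fromℕ (A C (k ℕ.+ B)) + fromℕ (A C suc (k ℕ.+ B))
  pascal k = trans (cong fromℕ (sym (nCk+nC[k+1]≡[n+1]C[k+1] A (k ℕ.+ B))))
                   (fromℕ-+ (A C (k ℕ.+ B)) (A C suc (k ℕ.+ B)))

conv : ℕ → (ℕ → ℚ) → (ℕ → ℚ) → ℚ
conv d f g = sumTo d (λ i → f i * g (d ∸ i))

conv-cong : ∀ d {f f′ g g′ : ℕ → ℚ} → (∀ i → f i ≡ f′ i) → (∀ j → g j ≡ g′ j) →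
            conv d f g ≡ conv d f′ g′
conv-cong d f≗f′ g≗g′ = sumTo-cong d (λ i _ → cong₂ _*_ (f≗f′ i) (g≗g′ (d ∸ i)))

conv-subˡ : ∀ d f h g → conv d (λ i → f i - h i) g ≡ conv d f g - conv d h g
conv-subˡ d f h g =
  trans (sumTo-cong d (λ i _ → distrib (f i) (h i) (g (d ∸ i))))
        (sumTo-- d (λ i → f i * g (d ∸ i)) (λ i → h i * g (d ∸ i)))
  where
  distrib : ∀ a b x → (a - b) * x ≡ a * x - b * x
  distrib = solve 3 (λ a b x → (a :- b) :* x := a :* x :- b :* x) refl

conv-subʳ : ∀ d f g h → conv d f (λ j → g j - h j) ≡ conv d f g - conv d f h
conv-subʳ d f g h =
  trans (sumTo-cong d (λ i _ → distrib (f i) (g (d ∸ i)) (h (d ∸ i))))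
        (sumTo-- d (λ i → f i * g (d ∸ i)) (λ i → f i * h (d ∸ i)))
  where
  distrib : ∀ x a b → x * (a - b) ≡ x * a - x * b
  distrib = solve 3 (λ x a b → x :* (a :- b) := x :* a :- x :* b) refl

conv-shiftˡ : ∀ d f g → conv (suc d) (shift f) g ≡ conv d f g
conv-shiftˡ d f g =
  trans (sumTo-suc d (λ i → shift f i * g (suc d ∸ i)))
        (trans (cong (_+ conv d f g) (ℚP.*-zeroˡ (g (suc d)))) (ℚP.+-identityˡ (conv d f g)))

conv-shiftʳ : ∀ d f g → conv (suc d) f (shift g) ≡ conv d f g
conv-shiftʳ d f g =
  trans (cong₂ _+_ (sumTo-cong d (λ i i≤d → cong (λ t → f i * shift g t) (ℕP.+-∸-assoc 1 i≤d)))
                   (trans (cong (λ t → f (suc d) * shift g t) (ℕP.n∸n≡0 d)) (ℚP.*-zeroʳ (f (suc d)))))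
        (ℚP.+-identityʳ (conv d f g))

conv-shift-swap : ∀ d f g → conv d (shift f) g ≡ conv d f (shift g)
conv-shift-swap zero f g = trans (ℚP.*-zeroˡ (g 0)) (sym (ℚP.*-zeroʳ (f 0)))
conv-shift-swap (suc d) f g = trans (conv-shiftˡ d f g) (sym (conv-shiftʳ d f g))

-- coefficients of (1 - x)^N and of (1 - x)^-(M+1)
binomAlt : ℕ → ℕ → ℚ
binomAlt N i = sgnℕ i * fromℕ (N C i)

binomNeg : ℕ → ℕ → ℚ
binomNeg M j = fromℕ ((j ℕ.+ M) C M)

binomAlt-pascal : ∀ N i → binomAlt (suc N) i ≡ binomAlt N i - shift (binomAlt N) i
binomAlt-pascal N zero = refl
binomAlt-pascal N (suc i) =
  trans (cong (sgnℕ (suc i) *_)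
              (trans (cong fromℕ (sym (nCk+nC[k+1]≡[n+1]C[k+1] N i))) (fromℕ-+ (N C i) (N C suc i))))
        (regroup (sgnℕ i) (fromℕ (N C i)) (fromℕ (N C suc i)))
  where
  regroup : ∀ s x y → (- 1ℚ * s) * (x + y) ≡ (- 1ℚ * s) * y - s * x
  regroup = solve 3 (λ s x y → ((:- con 1ℚ) :* s) :* (x :+ y) := ((:- con 1ℚ) :* s) :* y :- s :* x) refl

binomNeg-pascal : ∀ M j → binomNeg M j ≡ binomNeg (suc M) j - shift (binomNeg (suc M)) j
binomNeg-pascal M zero =
  trans (cong fromℕ (nCn≡1 M)) (sym (cong (λ z → fromℕ z - 0ℚ) (nCn≡1 (suc M))))
binomNeg-pascal M (suc j) = sym (begin
  fromℕ (suc n C suc M) - fromℕ (n C suc M)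
    ≡⟨ cong (λ z → fromℕ z - fromℕ (n C suc M)) (sym (nCk+nC[k+1]≡[n+1]C[k+1] n M)) ⟩
  fromℕ (n C M ℕ.+ n C suc M) - fromℕ (n C suc M)
    ≡⟨ cong (_- fromℕ (n C suc M)) (fromℕ-+ (n C M) (n C suc M)) ⟩
  fromℕ (n C M) + fromℕ (n C suc M) - fromℕ (n C suc M)
    ≡⟨ cancel (fromℕ (n C M)) (fromℕ (n C suc M)) ⟩
  fromℕ (n C M)
    ≡⟨ cong (λ t → fromℕ (t C M)) (ℕP.+-suc j M) ⟩
  binomNeg M (suc j) ∎)
  where
  n = j ℕ.+ suc M
  cancel : ∀ x y → x + y - y ≡ x
  cancel = solve 2 (λ x y → x :+ y :- y := x) refl

conv-binom-step : ∀ N M d → conv d (binomAlt (suc N)) (binomNeg (suc M)) ≡ conv d (binomAlt N) (binomNeg M)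
conv-binom-step N M d = begin
  conv d (binomAlt (suc N)) B
    ≡⟨ conv-cong d {g = B} (binomAlt-pascal N) (λ _ → refl) ⟩
  conv d (λ i → A i - shift A i) B
    ≡⟨ conv-subˡ d A (shift A) B ⟩
  conv d A B - conv d (shift A) B
    ≡⟨ cong (_-_ (conv d A B)) (conv-shift-swap d A B) ⟩
  conv d A B - conv d A (shift B)
    ≡⟨ conv-subʳ d A B (shift B) ⟨
  conv d A (λ j → B j - shift B j)
    ≡⟨ conv-cong d {f = A} (λ _ → refl) (λ j → sym (binomNeg-pascal M j)) ⟩
  conv d A (binomNeg M) ∎
  where
  A = binomAlt N
  B = binomNeg (suc M)

conv-binom-reduce : ∀ M d → conv d (binomAlt (M ℕ.+ d)) (binomNeg M) ≡ conv d (binomAlt d) (binomNeg 0)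
conv-binom-reduce zero d = refl
conv-binom-reduce (suc M) d = trans (conv-binom-step (M ℕ.+ d) M d) (conv-binom-reduce M d)

-- binomNeg 0 is constantly 1 by computation
conv-binomNeg₀ : ∀ d f → conv d f (binomNeg 0) ≡ sumTo d f
conv-binomNeg₀ d f = sumTo-cong d (λ i _ → ℚP.*-identityʳ (f i))

alternating-row-sum : ∀ d → sumTo (suc d) (binomAlt (suc d)) ≡ 0ℚ
alternating-row-sum d = begin
  sumTo (suc d) (binomAlt (suc d))
    ≡⟨ sumTo-cong (suc d) (λ i _ → binomAlt-pascal d i) ⟩
  sumTo (suc d) (λ i → A i - shift A i)
    ≡⟨ sumTo-- (suc d) A (shift A) ⟩
  sumTo (suc d) A - sumTo (suc d) (shift A)
    ≡⟨ cong (_-_ (sumTo (suc d) A)) (sumTo-shift d A) ⟩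
  sumTo d A + A (suc d) - sumTo d A
    ≡⟨ cancel (sumTo d A) (A (suc d)) ⟩
  sgnℕ (suc d) * fromℕ (d C suc d)
    ≡⟨ cong (λ z → sgnℕ (suc d) * fromℕ z) (k>n⇒nCk≡0 (ℕP.n<1+n d)) ⟩
  sgnℕ (suc d) * 0ℚ
    ≡⟨ ℚP.*-zeroʳ (sgnℕ (suc d)) ⟩
  0ℚ ∎
  where
  A = binomAlt d
  cancel : ∀ x y → x + y - x ≡ y
  cancel = solve 2 (λ x y → x :+ y :- x := y) refl

Φcoeff : ℕ → ℕ → ℚ
Φcoeff n′ e = ½ * qpow ½ e * binomNeg n′ e

Φβ-term : ℕ → ℕ → ℕ → ℚ
Φβ-term n′ e k =
  ½ * qpow (- ½) k * (fromℕ ((suc (n′ ℕ.+ k) ℕ.+ (e ∸ k)) C suc (n′ ℕ.+ k)) * qpow ½ (e ∸ k))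

Φβ-index : ∀ n′ {k e} → k ≤ e → n′ ℕ.+ k ℕ.+ (e ∸ k) ≡ e ℕ.+ n′
Φβ-index n′ {k} {e} k≤e =
  trans (ℕP.+-assoc n′ k (e ∸ k)) (trans (cong (n′ ℕ.+_) (ℕP.m+[n∸m]≡n k≤e)) (ℕP.+-comm n′ e))

Φβ-term-≤ : ∀ n′ e k → k ≤ e →
  Φβ-term n′ e k ≡ ½ * qpow ½ e * (sgnℕ k * fromℕ (suc (e ℕ.+ n′) C suc (k ℕ.+ n′)))
Φβ-term-≤ n′ e k k≤e = begin
  Φβ-term n′ e k
    ≡⟨ cong₂ (λ s b → ½ * s * (fromℕ b * qpow ½ (e ∸ k))) (qpow-neg ½ k) binomial≡ ⟩
  ½ * (sgnℕ k * qpow ½ k) * (C′ * qpow ½ (e ∸ k))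
    ≡⟨ regroup ½ (sgnℕ k) (qpow ½ k) C′ (qpow ½ (e ∸ k)) ⟩
  ½ * (qpow ½ k * qpow ½ (e ∸ k)) * (sgnℕ k * C′)
    ≡⟨ cong (λ z → ½ * z * (sgnℕ k * C′)) (qpow-split ½ k≤e) ⟩
  ½ * qpow ½ e * (sgnℕ k * C′) ∎
  where
  C′ = fromℕ (suc (e ℕ.+ n′) C suc (k ℕ.+ n′))
  binomial≡ : (suc (n′ ℕ.+ k) ℕ.+ (e ∸ k)) C suc (n′ ℕ.+ k) ≡ suc (e ℕ.+ n′) C suc (k ℕ.+ n′)
  binomial≡ = cong₂ (λ t b → suc t C suc b) (Φβ-index n′ k≤e) (ℕP.+-comm n′ k)
  regroup : ∀ h s p c q → h * (s * p) * (c * q) ≡ h * (p * q) * (s * c)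
  regroup = solve 5 (λ h s p c q → h :* (s :* p) :* (c :* q) := h :* (p :* q) :* (s :* c)) refl

Σ-Φβ-term : ∀ n′ e → sumTo e (Φβ-term n′ e) ≡ Φcoeff n′ e
Σ-Φβ-term n′ e = begin
  sumTo e (Φβ-term n′ e)
    ≡⟨ sumTo-cong e (Φβ-term-≤ n′ e) ⟩
  sumTo e (λ k → ½ * qpow ½ e * (sgnℕ k * fromℕ (suc (e ℕ.+ n′) C suc (k ℕ.+ n′))))
    ≡⟨ sumTo-*ˡ e _ (½ * qpow ½ e) ⟩
  ½ * qpow ½ e * sumTo e (λ k → sgnℕ k * fromℕ (suc (e ℕ.+ n′) C suc (k ℕ.+ n′)))
    ≡⟨ cong (½ * qpow ½ e *_) (alternating-binomial-tail (e ℕ.+ n′) n′ e) ⟩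
  ½ * qpow ½ e * (binomNeg n′ e + sgnℕ e * fromℕ ((e ℕ.+ n′) C suc (e ℕ.+ n′)))
    ≡⟨ cong (λ z → ½ * qpow ½ e * (binomNeg n′ e + sgnℕ e * fromℕ z))
            (k>n⇒nCk≡0 (ℕP.n<1+n (e ℕ.+ n′))) ⟩
  ½ * qpow ½ e * (binomNeg n′ e + sgnℕ e * 0ℚ)
    ≡⟨ cong (λ z → ½ * qpow ½ e * (binomNeg n′ e + z)) (ℚP.*-zeroʳ (sgnℕ e)) ⟩
  ½ * qpow ½ e * (binomNeg n′ e + 0ℚ)
    ≡⟨ cong (½ * qpow ½ e *_) (ℚP.+-identityʳ (binomNeg n′ e)) ⟩
  Φcoeff n′ e ∎

Φβ-coefficient : ∀ n′ e X → ⟪ Φβ (+ suc n′) e ∣ X ⟫ ≡ Φcoeff n′ e * X (+ suc (e ℕ.+ n′))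
Φβ-coefficient n′ e X = begin
  ⟪ Φβ (+ suc n′) e ∣ X ⟫
    ≡⟨ ⟪⟫-concatMap-upTo G e X ⟩
  sumTo e (λ k → Φβ-term n′ e k * X (+ suc (n′ ℕ.+ k ℕ.+ (e ∸ k))) + 0ℚ)
    ≡⟨ sumTo-cong e (λ k k≤e → trans (ℚP.+-identityʳ _)
                                     (cong (λ b → Φβ-term n′ e k * X (+ suc b)) (Φβ-index n′ k≤e))) ⟩
  sumTo e (λ k → Φβ-term n′ e k * X (+ suc (e ℕ.+ n′)))
    ≡⟨ sumTo-*ʳ e (Φβ-term n′ e) _ ⟩
  sumTo e (Φβ-term n′ e) * X (+ suc (e ℕ.+ n′))
    ≡⟨ cong (_* X (+ suc (e ℕ.+ n′))) (Σ-Φβ-term n′ e) ⟩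
  Φcoeff n′ e * X (+ suc (e ℕ.+ n′)) ∎
  where
  -- Φβ (+ suc n′) e unfolds to concatMap G (L.upTo (suc e))
  G : ℕ → Ferm
  G k = (Φβ-term n′ e k , + suc (n′ ℕ.+ k ℕ.+ (e ∸ k))) ∷ []

-- the β^e-coefficient of ⟨vac| φ_a Φ^{(β)}_{n′+1} e^{θ*} |vac⟩
vevφΦ : ℕ → ℕ → ℤ → ℚ
vevφΦ n′ e a = Φcoeff n′ e * vacPair a (suc (e ℕ.+ n′))

vev-φ-Φβ : ∀ n′ a e →
  ⟨ vac∣ ·φ a ∣ applyS (fermOp (Φβ (+ suc n′))) (expθ* 1ℚ vacS) e ⟩ ≡ vevφΦ n′ e a
vev-φ-Φβ n′ a e = begin
  ⟨ vac∣ ·φ a ∣ applyS (fermOp (Φβ (+ suc n′))) E e ⟩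
    ≡⟨ ⟨∣⟩-applyS-fermOp (vac∣ ·φ a) (Φβ (+ suc n′)) E e ⟩
  sumTo e (λ i → ⟪ Φβ (+ suc n′) i ∣ (λ b → ⟨ vac∣ ·φ a ·φ b ∣ E (e ∸ i) ⟩) ⟫)
    ≡⟨ sumTo-cong e (λ i _ → Φβ-coefficient n′ i (λ b → ⟨ vac∣ ·φ a ·φ b ∣ E (e ∸ i) ⟩)) ⟩
  sumTo e (λ i → Φcoeff n′ i * ⟨ vac∣ ·φ a ·φ (+ suc (i ℕ.+ n′)) ∣ E (e ∸ i) ⟩)
    ≡⟨ sumTo-cong e (λ i _ → cong (Φcoeff n′ i *_) (pair-out i)) ⟩
  sumTo e (λ i → Φcoeff n′ i * (vacPair a (suc (i ℕ.+ n′)) * ⟨ vac∣ ∣ vacS (e ∸ i) ⟩))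
    ≡⟨ sumTo-cong e (λ i _ → sym (ℚP.*-assoc (Φcoeff n′ i) _ _)) ⟩
  sumTo e (λ i → vevφΦ n′ i a * ⟨ vac∣ ∣ vacS (e ∸ i) ⟩)
    ≡⟨ sumTo-last e _ (λ i i<e → trans (cong (vevφΦ n′ i a *_) (vev-vacS e i i<e))
                                       (ℚP.*-zeroʳ (vevφΦ n′ i a))) ⟩
  vevφΦ n′ e a * ⟨ vac∣ ∣ vacS (e ∸ e) ⟩
    ≡⟨ cong (λ t → vevφΦ n′ e a * ⟨ vac∣ ∣ vacS t ⟩) (ℕP.n∸n≡0 e) ⟩
  vevφΦ n′ e a * 1ℚ
    ≡⟨ ℚP.*-identityʳ (vevφΦ n′ e a) ⟩
  vevφΦ n′ e a ∎
  where
  E = expθ* 1ℚ vacS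
  pair-out : ∀ i → ⟨ vac∣ ·φ a ·φ (+ suc (i ℕ.+ n′)) ∣ E (e ∸ i) ⟩
                   ≡ vacPair a (suc (i ℕ.+ n′)) * ⟨ vac∣ ∣ vacS (e ∸ i) ⟩
  pair-out i = trans (⟨vac·φ·φ⁺∣⟩ a (i ℕ.+ n′) (E (e ∸ i)))
                     (cong (vacPair a (suc (i ℕ.+ n′)) *_) (vev-expθ* 1ℚ vacS (e ∸ i)))

lhs-contraction : ∀ n′ m d →
  lhs (+ suc n′) m d ≡ sumTo d (λ i → ⟪ φ[β]* m i ∣ vevφΦ n′ (d ∸ i) ⟫)
lhs-contraction n′ m d = begin
  lhs (+ suc n′) m d
    ≡⟨ vev≡⟨vac∣⟩ (expθ* (- 1ℚ) W d) ⟩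
  ⟨ vac∣ ∣ expθ* (- 1ℚ) W d ⟩
    ≡⟨ vev-expθ* (- 1ℚ) W d ⟩
  ⟨ vac∣ ∣ W d ⟩
    ≡⟨ ⟨∣⟩-applyS-fermOp vac∣ (φ[β]* m) ΦE d ⟩
  sumTo d (λ i → ⟪ φ[β]* m i ∣ (λ a → ⟨ vac∣ ·φ a ∣ ΦE (d ∸ i) ⟩) ⟫)
    ≡⟨ sumTo-cong d (λ i _ → ⟪⟫-cong (φ[β]* m i) (λ a → vev-φ-Φβ n′ a (d ∸ i))) ⟩
  sumTo d (λ i → ⟪ φ[β]* m i ∣ vevφΦ n′ (d ∸ i) ⟫) ∎
  where
  ΦE = applyS (fermOp (Φβ (+ suc n′))) (expθ* 1ℚ vacS)
  W = applyS (fermOp (φ[β]* m)) ΦE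

⟪φ[β]*⁺⟫-≤ : ∀ r i X → i ≤ r →
  ⟪ φ[β]* (+ suc r) i ∣ X ⟫ ≡ sgnℕ (suc r ∸ i) * (sgnℕ i * fromℕ (r C i) * qpow ½ i) * X -[1+ r ∸ i ]
⟪φ[β]*⁺⟫-≤ r i X i≤r =
  trans (cong (λ b → ⟪ starF (if b then (c , + (suc r ∸ i)) ∷ [] else []) ∣ X ⟫)
              (dec-true (i ℕ.≤? r) i≤r))
        (trans (ℚP.+-identityʳ _)
               (cong (λ z → sgnℕ (suc r ∸ i) * c * X (ℤ.- (+ z))) (ℕP.+-∸-assoc 1 i≤r)))
  where c = sgnℕ i * fromℕ (r C i) * qpow ½ i

⟪φ[β]*⁺⟫-> : ∀ r i X → ¬ i ≤ r → ⟪ φ[β]* (+ suc r) i ∣ X ⟫ ≡ 0ℚ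
⟪φ[β]*⁺⟫-> r i X i≰r =
  cong (λ b → ⟪ starF (if b then (c , + (suc r ∸ i)) ∷ [] else []) ∣ X ⟫) (dec-false (i ℕ.≤? r) i≰r)
  where c = sgnℕ i * fromℕ (r C i) * qpow ½ i

contraction-nonpositive : ∀ n′ m e i → m ℤ.≤ + 0 → ⟪ φ[β]* m i ∣ vevφΦ n′ e ⟫ ≡ 0ℚ
contraction-nonpositive n′ (+ zero) e i _ =
  trans (ℚP.+-identityʳ _)
        (trans (cong (λ a → c * vevφΦ n′ e a) (ℤP.neg-involutive (+ i)))
               (trans (cong (c *_) (ℚP.*-zeroʳ (Φcoeff n′ e))) (ℚP.*-zeroʳ c)))
  where c = sgnℤ (ℤ.- (+ i)) * qpow ½ i
contraction-nonpositive n′ -[1+ q ] e i _ =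
  trans (ℚP.+-identityʳ _) (trans (cong (c *_) (ℚP.*-zeroʳ (Φcoeff n′ e))) (ℚP.*-zeroʳ c))
  where c = sgnℤ (ℤ.- (+ (suc q ℕ.+ i))) * (fromℕ ((suc q ℕ.+ i) C suc q) * qpow ½ i)
contraction-nonpositive n′ (+ suc r) e i (ℤ.+≤+ ())

contraction-diag : ∀ n′ d i → i ≤ d →
  ⟪ φ[β]* (+ suc (n′ ℕ.+ d)) i ∣ vevφΦ n′ (d ∸ i) ⟫
    ≡ qpow ½ d * (binomAlt (n′ ℕ.+ d) i * binomNeg n′ (d ∸ i))
contraction-diag n′ d i i≤d = begin
  ⟪ φ[β]* (+ suc r) i ∣ vevφΦ n′ (d ∸ i) ⟫
    ≡⟨ ⟪φ[β]*⁺⟫-≤ r i (vevφΦ n′ (d ∸ i)) i≤r ⟩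
  sgnℕ (suc r ∸ i) * α * (Φcoeff n′ (d ∸ i) * vacPair -[1+ r ∸ i ] (suc X))
    ≡⟨ cong₂ (λ u v → sgnℕ u * α * (Φcoeff n′ (d ∸ i) * vacPair -[1+ v ] (suc X)))
             (trans (ℕP.+-∸-assoc 1 i≤r) (cong suc r∸i≡X)) r∸i≡X ⟩
  sgnℕ (suc X) * α * (Φcoeff n′ (d ∸ i) * vacPair -[1+ X ] (suc X))
    ≡⟨ cong (λ v → sgnℕ (suc X) * α * (Φcoeff n′ (d ∸ i) * v)) (vacPair-diag X) ⟩
  sgnℕ (suc X) * α * (½ * qpow ½ (d ∸ i) * Cn * (fromℕ 2 * sgnℕ (suc X)))
    ≡⟨ regroup (sgnℕ (suc X)) (sgnℕ i) Cr (qpow ½ i) (qpow ½ (d ∸ i)) Cn (sgnℕ-square (suc X)) ⟩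
  qpow ½ i * qpow ½ (d ∸ i) * (sgnℕ i * Cr * Cn)
    ≡⟨ cong (_* (sgnℕ i * Cr * Cn)) (qpow-split ½ i≤d) ⟩
  qpow ½ d * (binomAlt r i * binomNeg n′ (d ∸ i)) ∎
  where
  r = n′ ℕ.+ d
  X = d ∸ i ℕ.+ n′
  Cr = fromℕ (r C i)
  Cn = binomNeg n′ (d ∸ i)
  α = sgnℕ i * Cr * qpow ½ i
  i≤r : i ≤ r
  i≤r = ℕP.≤-trans i≤d (ℕP.m≤n+m d n′)
  r∸i≡X : r ∸ i ≡ X
  r∸i≡X = trans (ℕP.+-∸-assoc n′ i≤d) (ℕP.+-comm n′ (d ∸ i))
  regroup : ∀ S s c h h′ c′ → S * S ≡ 1ℚ →
            S * (s * c * h) * (½ * h′ * c′ * (fromℕ 2 * S)) ≡ h * h′ * (s * c * c′)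
  regroup S s c h h′ c′ S²≡1 =
    trans (solve 6 (λ S s c h h′ c′ → S :* (s :* c :* h) :* (con ½ :* h′ :* c′ :* (con (fromℕ 2) :* S))
                                      := (S :* S) :* (h :* h′ :* (s :* c :* c′))) refl S s c h h′ c′)
          (trans (cong (_* (h * h′ * (s * c * c′))) S²≡1) (ℚP.*-identityˡ _))

contraction-offdiag : ∀ n′ r d i → r ≢ n′ ℕ.+ d → i ≤ d →
                      ⟪ φ[β]* (+ suc r) i ∣ vevφΦ n′ (d ∸ i) ⟫ ≡ 0ℚ
contraction-offdiag n′ r d i r≢n′+d i≤d with i ℕ.≤? r
... | no i≰r = ⟪φ[β]*⁺⟫-> r i (vevφΦ n′ (d ∸ i)) i≰r
... | yes i≤r =
  trans (⟪φ[β]*⁺⟫-≤ r i (vevφΦ n′ (d ∸ i)) i≤r)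
        (trans (cong (λ v → c * (Φcoeff n′ (d ∸ i) * v)) (vacPair-offdiag (r ∸ i) (d ∸ i ℕ.+ n′) charges≢))
               (trans (cong (c *_) (ℚP.*-zeroʳ (Φcoeff n′ (d ∸ i)))) (ℚP.*-zeroʳ c)))
  where
  c = sgnℕ (suc r ∸ i) * (sgnℕ i * fromℕ (r C i) * qpow ½ i)
  charges≢ : r ∸ i ≢ d ∸ i ℕ.+ n′
  charges≢ eq = r≢n′+d (begin
    r                       ≡⟨ ℕP.m∸n+n≡m i≤r ⟨
    r ∸ i ℕ.+ i             ≡⟨ cong (ℕ._+ i) (trans eq (ℕP.+-comm (d ∸ i) n′)) ⟩
    n′ ℕ.+ (d ∸ i) ℕ.+ i    ≡⟨ ℕP.+-assoc n′ (d ∸ i) i ⟩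
    n′ ℕ.+ (d ∸ i ℕ.+ i)    ≡⟨ cong (n′ ℕ.+_) (ℕP.m∸n+n≡m i≤d) ⟩
    n′ ℕ.+ d                ∎)

δS-≢ : ∀ n m d → n ≢ m → δS n m d ≡ 0ℚ
δS-≢ n m zero n≢m = cong (λ b → if b then 1ℚ else 0ℚ) (dec-false (n ℤ.≟ m) n≢m)
δS-≢ n m (suc d) _ = refl

Σ-contraction≡δ : ∀ n′ m d →
  sumTo d (λ i → ⟪ φ[β]* m i ∣ vevφΦ n′ (d ∸ i) ⟫) ≡ δS (+ suc n′) m d
Σ-contraction≡δ n′ (+ zero) d =
  trans (sumTo-zero d _ (λ i _ → contraction-nonpositive n′ (+ 0) (d ∸ i) i (ℤ.+≤+ z≤n)))
        (sym (δS-≢ (+ suc n′) (+ 0) d λ ()))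
Σ-contraction≡δ n′ -[1+ q ] d =
  trans (sumTo-zero d _ (λ i _ → contraction-nonpositive n′ -[1+ q ] (d ∸ i) i ℤ.-≤+))
        (sym (δS-≢ (+ suc n′) -[1+ q ] d λ ()))
Σ-contraction≡δ n′ (+ suc r) d with r ℕ.≟ n′ ℕ.+ d
... | no r≢n′+d =
  trans (sumTo-zero d _ (λ i → contraction-offdiag n′ r d i r≢n′+d)) (sym (δS-off d r≢n′+d))
  where
  δS-off : ∀ d → r ≢ n′ ℕ.+ d → δS (+ suc n′) (+ suc r) d ≡ 0ℚ
  δS-off zero r≢n′+0 = δS-≢ (+ suc n′) (+ suc r) 0
    (λ eq → r≢n′+0 (trans (sym (ℕP.suc-injective (ℤP.+-injective eq))) (sym (ℕP.+-identityʳ n′))))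
  δS-off (suc d) _ = refl
... | yes refl = begin
  sumTo d (λ i → ⟪ φ[β]* (+ suc (n′ ℕ.+ d)) i ∣ vevφΦ n′ (d ∸ i) ⟫)
    ≡⟨ sumTo-cong d (contraction-diag n′ d) ⟩
  sumTo d (λ i → qpow ½ d * (binomAlt (n′ ℕ.+ d) i * binomNeg n′ (d ∸ i)))
    ≡⟨ sumTo-*ˡ d _ (qpow ½ d) ⟩
  qpow ½ d * conv d (binomAlt (n′ ℕ.+ d)) (binomNeg n′)
    ≡⟨ cong (qpow ½ d *_) (conv-binom-reduce n′ d) ⟩
  qpow ½ d * conv d (binomAlt d) (binomNeg 0)
    ≡⟨ diagonal d ⟩
  δS (+ suc n′) (+ suc (n′ ℕ.+ d)) d ∎
  where
  diagonal : ∀ d → qpow ½ d * conv d (binomAlt d) (binomNeg 0) ≡ δS (+ suc n′) (+ suc (n′ ℕ.+ d)) d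
  diagonal zero =
    sym (cong (λ b → if b then 1ℚ else 0ℚ)
              (dec-true (+ suc n′ ℤ.≟ + suc (n′ ℕ.+ 0)) (cong (λ z → + suc z) (sym (ℕP.+-identityʳ n′)))))
  diagonal (suc d) =
    trans (cong (qpow ½ (suc d) *_) (trans (conv-binomNeg₀ (suc d) (binomAlt (suc d))) (alternating-row-sum d)))
          (ℚP.*-zeroʳ (qpow ½ (suc d)))

lemma3p18 : (n m : ℤ) → + 0 < n → (d : ℕ) → lhs n m d ≡ δS n m d
lemma3p18 (+ suc n′) m _ d = trans (lhs-contraction n′ m d) (Σ-contraction≡δ n′ m d)
lemma3p18 (+ zero) m (ℤ.+<+ ()) d
lemma3p18 -[1+ _ ] m () d
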